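{- The set $T=\{\mathsf{tr}_x : x\in V_\omega\}$ is precisely the set of all compactly branching, strongly extensional trees (up to isomorphism).
   Context: A tree is a directed graph with a root from which every node is reachable by a unique directed path; trees are unordered and identified up to isomorphism. Tree bisimulation between $t,u$: relation $R$ on nodes with (a) if $xRy$, every child of $x$ is related to some child of $y$ and vice versa; (b) roots are related to each other and to no other nodes; (c) related nodes have related parents. $t$ is strongly extensional if every tree bisimulation on $t$ is contained in the diagonal. Let $\mathcal{P}_f$ be the finite power set functor; $\mathcal{P}_f^0 1=\{*\}$, $\mathcal{P}_f^{n+1}1=\mathcal{P}_f(\mathcal{P}_f^n1)$, with maps $\mathcal{P}_f^n!\colon\mathcal{P}_f^{n+1}1\to\mathcal{P}_f^n1$ ($!$ the unique map to $1$, $\mathcal{P}_f^{n+1}!=\mathcal{P}_f(\mathcal{P}_f^n!)$ acting by direct image). $V_\omega$ is the set of sequences $x=(x_n)_{n<\omega}$ with $x_n\in\mathcal{P}_f^n1$ and $\mathcal{P}_f^n!(x_{n+1})=x_n$. For a tree $t$ define $\rho^t_n\colon t\to\mathcal{P}_f^n1$ by $\rho^t_0(x)=*$, $\rho^t_{n+1}(x)=\{\rho^t_n(y): y \text{ a child of } x\}$. For nodes $x_0,x_1,\dots,y$ of $t$, write $\lim x_n=y$ if for every $n$ there is $m$ with $\rho^t_n(x_p)=\rho^t_n(y)$ for all $p\ge m$. $t$ is compactly branching if for each node $x$ and each sequence $(y_n)$ of children of $x$ there is a subsequence $(w_n)$ and a child $z$ of $x$ with $\lim w_n=z$. For $x,y\in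 V_\omega$ write $x\leadsto y$ iff $y_n\in x_{n+1}$ for all $n$. For $x\in V_\omega$, $\mathsf{tr}_x$ is the tree whose nodes are the finite sequences $\langle x^1,\dots,x^k\rangle$ ($k\ge1$) of elements of $V_\omega$ with $x^1=x$ and $x^i\leadsto x^{i+1}$ for all $i<k$, with root $\langle x\rangle$ and with an edge from $\langle x^1,\dots,x^k\rangle$ to each $\langle x^1,\dots,x^k,y\rangle$. -}

module Defs where

open import Level using (Level) renaming (suc to lsuc; zero to lzero)
open import Function using (_∘_)
open import Data.Nat using (ℕ; zero; suc; _≤_; _<_)
open import Data.Unit using (⊤; tt)
open import Data.Empty using (⊥)
open import Data.Product using (Σ; ∃; ∃-syntax; _×_; _,_; proj₁; proj₂)
open import Data.List using (List; []; _∷_; map)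
open import Data.List.Relation.Unary.Any using (Any)
open import Data.List.Relation.Unary.All using (All)
open import Relation.Binary using (IsEquivalence)

-- The finite power-set tower  P_f^n 1  (hereditarily finite sets of rank < n)
-- An element of P_f^{n+1} 1 is represented by a finite list of elements of
-- P_f^n 1; equality is extensional set equality _≋_ (defined by recursion).

PF : ℕ → Set
PF zero    = ⊤
PF (suc n) = List (PF n)

infix 4 _≋_ _∈ₕ_

_≋_ : ∀ {n} → PF n → PF n → Set
_≋_ {zero}  _ _ = ⊤
_≋_ {suc n} a b =
  (∀ x → Any (x ≋_) a → Any (x ≋_) b) × (∀ x → Any (x ≋_) b → Any (x ≋_) a)

_∈ₕ_ : ∀ {n} → PF n → PF (suc n) → Set
x ∈ₕ a = Any (x ≋_) a

bang : ∀ n → PF (suc n) → PF n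
bang zero    _ = tt
bang (suc n) a = map (bang n) a

record Vω : Set where
  constructor mkV
  field
    seq : (n : ℕ) → PF n
    coh : (n : ℕ) → bang n (seq (suc n)) ≋ seq n
open Vω public

_≈V_ : Vω → Vω → Set
x ≈V y = ∀ n → seq x n ≋ seq y n

_⇝_ : Vω → Vω → Set
x ⇝ y = ∀ n → seq y n ∈ₕ seq x (suc n)

-- Rooted graphs on a setoid of nodes; _⇒_ x y means "y is a child of x".

record RootedGraph : Set₁ where
  field
    Node : Set
    _≈_  : Node → Node → Set
    _⇒_  : Node → Node → Set
    root : Node

module _ (G : RootedGraph) where
  open RootedGraph G

  data Path : Node → Set where
    start : ∀ {x} → root ≈ x → Path x
    step  : ∀ {x y} → Path x → x ⇒ y → Path y

  data PathEq : ∀ {x x'} → Path x → Path x' → Set where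
    start : ∀ {x x'} {e : root ≈ x} {e' : root ≈ x'} → PathEq (start e) (start e')
    step  : ∀ {x x' y y'} {p : Path x} {q : Path x'} {e : x ⇒ y} {e' : x' ⇒ y'} →
            PathEq p q → x ≈ x' → PathEq (step p e) (step q e')

  record IsTree : Set where
    field
      isEquivalence : IsEquivalence _≈_
      ⇒-resp        : ∀ {x x' y y'} → x ≈ x' → y ≈ y' → x ⇒ y → x' ⇒ y'
      reachable     : ∀ x → Path x
      unique        : ∀ {x} (p q : Path x) → PathEq p q

  record IsTreeBisim (R : Node → Node → Set) : Set where
    field
      forth   : ∀ {a b} → R a b → ∀ {a'} → a ⇒ a' → ∃[ b' ] (b ⇒ b' × R a' b')
      back    : ∀ {a b} → R a b → ∀ {b'} → b ⇒ b' → ∃[ a' ] (a ⇒ a' × R a' b')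
      roots   : R root root
      rootˡ   : ∀ {b} → R root b → b ≈ root
      rootʳ   : ∀ {a} → R a root → a ≈ root
      parents : ∀ {a b pa pb} → pa ⇒ a → pb ⇒ b → R a b → R pa pb

  StronglyExtensional : Set₁
  StronglyExtensional =
    ∀ (R : Node → Node → Set) → IsTreeBisim R → ∀ {a b} → R a b → a ≈ b

  -- IsRho n a v  :  ρ_n(a) = v   (graph of ρ^t_n)
  IsRho : (n : ℕ) → Node → PF n → Set
  IsRho zero    a v = ⊤
  IsRho (suc n) a v =
    (∀ {a'} → a ⇒ a' → ∃[ w ] (IsRho n a' w × w ∈ₕ v)) ×
    All (λ w → ∃[ a' ] (a ⇒ a' × IsRho n a' w)) v

  SameRho : ℕ → Node → Node → Set
  SameRho n a b = ∃[ v ] (IsRho n a v × IsRho n b v)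

  Lim : (ℕ → Node) → Node → Set
  Lim xs y = ∀ n → ∃[ m ] (∀ p → m ≤ p → SameRho n (xs p) y)

  CompactlyBranching : Set
  CompactlyBranching =
    ∀ a (ys : ℕ → Node) → (∀ n → a ⇒ ys n) →
    ∃[ σ ] ((∀ n → σ n < σ (suc n)) × ∃[ z ] (a ⇒ z × Lim (ys ∘ σ) z))

record _≅_ (G H : RootedGraph) : Set where
  private
    module G = RootedGraph G
    module H = RootedGraph H
  field
    to        : G.Node → H.Node
    from      : H.Node → G.Node
    to-cong   : ∀ {a b} → a G.≈ b → to a H.≈ to b
    from-cong : ∀ {a b} → a H.≈ b → from a G.≈ from b
    to-from   : ∀ b → to (from b) H.≈ b
    from-to   : ∀ a → from (to a) G.≈ a
    to-edge   : ∀ {a b} → a G.⇒ b → to a H.⇒ to b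
    from-edge : ∀ {a b} → a H.⇒ b → from a G.⇒ from b
    to-root   : to G.root H.≈ H.root

module _ (x : Vω) where

  -- ⟨x, x², …, xᵏ⟩ with x^i ⇝ x^{i+1}, indexed by its last entry
  data TrSeq : Vω → Set where
    []   : TrSeq x
    snoc : ∀ {y} → TrSeq y → (z : Vω) → y ⇝ z → TrSeq z

  data TrSeqEq : ∀ {y y'} → TrSeq y → TrSeq y' → Set where
    []   : TrSeqEq [] []
    snoc : ∀ {y y' z z'} {s : TrSeq y} {s' : TrSeq y'} {e : y ⇝ z} {e' : y' ⇝ z'} →
           TrSeqEq s s' → z ≈V z' → TrSeqEq (snoc s z e) (snoc s' z' e')

  TrNode : Set
  TrNode = Σ Vω TrSeq

  TrEdge : TrNode → TrNode → Set
  TrEdge (_ , s) (_ , [])          = ⊥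
  TrEdge (_ , s) (_ , snoc s' _ _) = TrSeqEq s s'

  tr : RootedGraph
  tr = record
    { Node = TrNode
    ; _≈_  = λ a b → TrSeqEq (proj₂ a) (proj₂ b)
    ; _⇒_  = TrEdge
    ; root = x , []
    }

-- In tr_x the node ending in y has ρ_n = y_n: every member of y_{n+1} is the n-th entry of some
-- ⇝-successor of y, by coherence of y. Hence tree-bisimilar nodes of tr_x end in the same element,
-- and strong extensionality follows by induction along the sequences; compact branching is
-- König's lemma, pigeonholing the children over the finite sets y_{n+1}. Conversely, in a
-- compactly branching tree t the values ρ_n(a) form an element ρ̂(a) of V_ω, and unfolding t along
-- the paths from the root gives a bounded morphism t → tr_{ρ̂(root)}: each ⇝-successor of ρ̂(a) is
-- the limit of approximating children, hence ρ̂ of a child. The kernel of a bounded morphism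
-- between trees is a tree bisimulation, so on a strongly extensional tree it is an isomorphism.
module Submission where

open import Defs
open import Level using (Lift; lift; lower) renaming (suc to lsuc; zero to lzero)
open import Function using (_∘_)
open import Data.Nat using (ℕ; zero; suc; _≤_; _<_; _≤′_; ≤′-refl; ≤′-step; _+_; _⊔_; z≤n; s≤s)
open import Data.Nat.Properties
  using (≤-refl; ≤-trans; m≤m⊔n; m≤n⊔m; m≤m+n; m≤n+m; ≤′⇒≤; ≤⇒≤′; 1+n≰n; z≤′n; s≤′s)
open import Data.Bool using (true; false)
open import Data.Unit using (⊤; tt)
open import Data.Empty using (⊥; ⊥-elim)
open import Data.Product using (Σ-syntax; ∃-syntax; _×_; _,_; proj₁; proj₂)
open import Data.List using (List; []; _∷_; map; _++_; filter)
open import Data.List.Relation.Unary.Any as Any using (Any; here; there)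
open import Data.List.Relation.Unary.All as All using (All)
open import Data.List.Relation.Unary.All.Properties using (all-filter) renaming (map⁺ to all-map⁺)
open import Data.List.Membership.Propositional using (_∈_; find; lose)
open import Data.List.Membership.Propositional.Properties using (∈-++⁺ˡ; ∈-++⁺ʳ; ∈-map⁺; ∈-filter⁺)
import Data.List.Membership.Setoid.Properties as SetoidMembership
open import Relation.Nullary using (Dec; yes; no; ¬_; does)
open import Relation.Nullary.Decidable using (map′)
open import Relation.Unary using (Decidable)
open import Relation.Binary using (IsEquivalence; Setoid)
open import Relation.Binary.PropositionalEquality using (_≡_; refl)
open import Axiom.ExcludedMiddle using (ExcludedMiddle)

≋-refl : ∀ {n} {a : PF n} → a ≋ a
≋-refl {zero}  = tt
≋-refl {suc n} = (λ _ h → h) , (λ _ h → h)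

≋-sym : ∀ {n} {a b : PF n} → a ≋ b → b ≋ a
≋-sym {zero}  _       = tt
≋-sym {suc n} (f , g) = g , f

≋-trans : ∀ {n} {a b c : PF n} → a ≋ b → b ≋ c → a ≋ c
≋-trans {zero}  _       _         = tt
≋-trans {suc n} (f , g) (f' , g') = (λ x → f' x ∘ f x) , (λ x → g x ∘ g' x)

≋-reflexive : ∀ {n} {a b : PF n} → a ≡ b → a ≋ b
≋-reflexive refl = ≋-refl

PF-setoid : ℕ → Setoid lzero lzero
PF-setoid n = record
  { Carrier       = PF n
  ; _≈_           = _≋_
  ; isEquivalence = record { refl = ≋-refl ; sym = ≋-sym ; trans = ≋-trans }
  }

∈ₕ-respˡ : ∀ {n} {x x' : PF n} {a} → x ≋ x' → x ∈ₕ a → x' ∈ₕ a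
∈ₕ-respˡ {n} = SetoidMembership.∈-resp-≈ (PF-setoid n)

∈ₕ-respʳ : ∀ {n} {x : PF n} {a b} → a ≋ b → x ∈ₕ a → x ∈ₕ b
∈ₕ-respʳ {x = x} (a⊆b , _) = a⊆b x

∈ₕ-map⁺ : ∀ {m n} {f : PF m → PF n} → (∀ {u v} → u ≋ v → f u ≋ f v) →
          ∀ {u a} → u ∈ₕ a → f u ∈ₕ map f a
∈ₕ-map⁺ {m} {n} = SetoidMembership.∈-map⁺ (PF-setoid m) (PF-setoid n)

map-cong-≋ : ∀ {m n} {f : PF m → PF n} → (∀ {u v} → u ≋ v → f u ≋ f v) →
             ∀ {a b} → a ≋ b → map f a ≋ map f b
map-cong-≋ {m} {n} {f} f-cong (a⊆b , b⊆a) = image a⊆b , image b⊆a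
  where
  image : ∀ {a b} → (∀ u → u ∈ₕ a → u ∈ₕ b) → ∀ x → x ∈ₕ map f a → x ∈ₕ map f b
  image a⊆b x x∈fa =
    let u , u∈a , x≋fu = SetoidMembership.∈-map⁻ (PF-setoid m) (PF-setoid n) x∈fa
    in ∈ₕ-respˡ (≋-sym x≋fu) (∈ₕ-map⁺ f-cong (a⊆b u u∈a))

bang-cong : ∀ n {a b : PF (suc n)} → a ≋ b → bang n a ≋ bang n b
bang-cong zero    _ = tt
bang-cong (suc n) e = map-cong-≋ (bang-cong n) e

bang-∈ₕ : ∀ n {u : PF (suc n)} {a} → u ∈ₕ a → bang n u ∈ₕ bang (suc n) a
bang-∈ₕ n = ∈ₕ-map⁺ (bang-cong n)

≈V-refl : ∀ y → y ≈V y
≈V-refl _ _ = ≋-refl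

≈V-sym : ∀ {y z} → y ≈V z → z ≈V y
≈V-sym e n = ≋-sym (e n)

≈V-trans : ∀ {y z w} → y ≈V z → z ≈V w → y ≈V w
≈V-trans e e' n = ≋-trans (e n) (e' n)

⇝-resp : ∀ {y y' z z'} → y ≈V y' → z ≈V z' → y ⇝ z → y' ⇝ z'
⇝-resp y≈y' z≈z' y⇝z n = ∈ₕ-respʳ (y≈y' (suc n)) (∈ₕ-respˡ (z≈z' n) (y⇝z n))

bang* : ∀ {m l} → m ≤′ l → PF l → PF m
bang* ≤′-refl     u = u
bang* (≤′-step p) u = bang* p (bang _ u)

bang*-irrelevant : ∀ {m l} (p q : m ≤′ l) (u : PF l) → bang* p u ≡ bang* q u
bang*-irrelevant ≤′-refl     ≤′-refl     u = refl
bang*-irrelevant ≤′-refl     (≤′-step q) u = ⊥-elim (1+n≰n (≤′⇒≤ q))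
bang*-irrelevant (≤′-step p) ≤′-refl     u = ⊥-elim (1+n≰n (≤′⇒≤ p))
bang*-irrelevant (≤′-step p) (≤′-step q) u = bang*-irrelevant p q _

bang*-cong : ∀ {m l} (p : m ≤′ l) {u u'} → u ≋ u' → bang* p u ≋ bang* p u'
bang*-cong ≤′-refl     e = e
bang*-cong (≤′-step p) e = bang*-cong p (bang-cong _ e)

bang-bang* : ∀ {m l} (p : m ≤′ l) (u : PF (suc l)) → bang m (bang* (s≤′s p) u) ≡ bang* p (bang l u)
bang-bang* ≤′-refl     u = refl
bang-bang* (≤′-step p) u = bang-bang* p (bang _ u)

module _ (y : Vω) where

  bang-∈ₕ-seq : ∀ {l u} → u ∈ₕ seq y (suc (suc l)) → bang l u ∈ₕ seq y (suc l)
  bang-∈ₕ-seq u∈y = ∈ₕ-respʳ (coh y (suc _)) (bang-∈ₕ _ u∈y)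

  bang*-∈ₕ-seq : ∀ {m l} (p : m ≤′ l) {u} → u ∈ₕ seq y (suc l) → bang* p u ∈ₕ seq y (suc m)
  bang*-∈ₕ-seq ≤′-refl     u∈y = u∈y
  bang*-∈ₕ-seq (≤′-step p) u∈y = bang*-∈ₕ-seq p (bang-∈ₕ-seq u∈y)

  lift-∈ₕ-seq : ∀ {m u} → u ∈ₕ seq y (suc m) →
                ∃[ u' ] (u' ∈ₕ seq y (suc (suc m)) × bang m u' ≋ u)
  lift-∈ₕ-seq {m} u∈y =
    let u' , u'∈y , u≋bu' = SetoidMembership.∈-map⁻ (PF-setoid (suc m)) (PF-setoid m)
                              (∈ₕ-respʳ (≋-sym (coh y (suc m))) u∈y)
    in u' , u'∈y , ≋-sym u≋bu'

  -- Lift w ∈ y_{n+1} step by step to members of y_{k+n+1} (bang maps y_{l+2} onto y_{l+1});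
  -- truncating them to level m gives z_m.
  ⇝-realize : ∀ n {w} → w ∈ₕ seq y (suc n) → ∃[ z ] (y ⇝ z × seq z n ≋ w)
  ⇝-realize n {w} w∈y = z , z-∈ , z-w n (level n)
    where
    thread : ∀ k → Σ[ u ∈ PF (k + n) ] (u ∈ₕ seq y (suc (k + n)))
    thread zero    = w , w∈y
    thread (suc k) = let u' , u'∈y , _ = lift-∈ₕ-seq (proj₂ (thread k)) in u' , u'∈y

    thread-coh : ∀ k → bang (k + n) (proj₁ (thread (suc k))) ≋ proj₁ (thread k)
    thread-coh k = proj₂ (proj₂ (lift-∈ₕ-seq (proj₂ (thread k))))

    level : ∀ m → m ≤′ m + n
    level zero    = z≤′n
    level (suc m) = s≤′s (level m)

    z : Vω
    z = mkV (λ m → bang* (level m) (proj₁ (thread m)))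
            (λ m → ≋-trans (≋-reflexive (bang-bang* (level m) _)) (bang*-cong (level m) (thread-coh m)))

    z-∈ : y ⇝ z
    z-∈ m = bang*-∈ₕ-seq (level m) (proj₂ (thread m))

    z-w : ∀ k (q : n ≤′ k + n) → bang* q (proj₁ (thread k)) ≋ w
    z-w zero q rewrite bang*-irrelevant q ≤′-refl w = ≋-refl
    z-w (suc k) q rewrite bang*-irrelevant q (≤′-step (≤⇒≤′ (m≤n+m n k))) (proj₁ (thread (suc k))) =
      ≋-trans (bang*-cong (≤⇒≤′ (m≤n+m n k)) (thread-coh k)) (z-w k (≤⇒≤′ (m≤n+m n k)))

module Rho (G : RootedGraph) (T : IsTree G) where
  open RootedGraph G
  open IsTree T
  private module ≈ = IsEquivalence isEquivalence

  IsRho-resp-≈ : ∀ n {a b v} → a ≈ b → IsRho G n a v → IsRho G n b v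
  IsRho-resp-≈ zero    _   _       = tt
  IsRho-resp-≈ (suc n) a≈b (f , g) =
    (λ b⇒ → f (⇒-resp (≈.sym a≈b) ≈.refl b⇒)) ,
    All.map (λ (a' , a⇒a' , r) → a' , ⇒-resp a≈b ≈.refl a⇒a' , r) g

  IsRho-resp-≋ : ∀ n {a v v'} → v ≋ v' → IsRho G n a v → IsRho G n a v'
  IsRho-resp-≋ zero    _ _ = tt
  IsRho-resp-≋ (suc n) {v' = v'} v≋v'@(_ , v'⊆v) (f , g) =
    (λ a⇒a' → let w , r , w∈v = f a⇒a' in w , r , ∈ₕ-respʳ v≋v' w∈v) ,
    All.tabulate λ {w} w∈v' →
      let u , u∈v , w≋u = find (v'⊆v w (lose w∈v' ≋-refl))
          a' , a⇒a' , r = All.lookup g u∈v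
      in a' , a⇒a' , IsRho-resp-≋ n (≋-sym w≋u) r

  IsRho-functional : ∀ n {a v w} → IsRho G n a v → IsRho G n a w → v ≋ w
  IsRho-functional zero    _ _ = tt
  IsRho-functional (suc n) ρv ρw = ⊆ ρv ρw , ⊆ ρw ρv
    where
    ⊆ : ∀ {a v w} → IsRho G (suc n) a v → IsRho G (suc n) a w → ∀ x → x ∈ₕ v → x ∈ₕ w
    ⊆ (_ , g) (f , _) x x∈v =
      let u , u∈v , x≋u = find x∈v
          a' , a⇒a' , r = All.lookup g u∈v
          u' , r' , u'∈w = f a⇒a'
      in ∈ₕ-respˡ (≋-sym (≋-trans x≋u (IsRho-functional n r r'))) u'∈w

  IsRho-bang : ∀ n {a v} → IsRho G (suc n) a v → IsRho G n a (bang n v)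
  IsRho-bang zero    _       = tt
  IsRho-bang (suc n) (f , g) =
    (λ a⇒a' → let w , r , w∈v = f a⇒a' in bang n w , IsRho-bang n r , bang-∈ₕ n w∈v) ,
    all-map⁺ (All.map (λ (a' , a⇒a' , r) → a' , a⇒a' , IsRho-bang n r) g)

  SameRho-transport : ∀ n {a b v} → SameRho G n a b → IsRho G n a v → IsRho G n b v
  SameRho-transport n (w , ρa , ρb) ρa' = IsRho-resp-≋ n (IsRho-functional n ρa ρa') ρb

  IsRho-bisim : ∀ {R} → IsTreeBisim G R → ∀ n {a b v} → R a b → IsRho G n a v → IsRho G n b v
  IsRho-bisim B zero    _   _       = tt
  IsRho-bisim B (suc n) aRb (f , g) =
    (λ b⇒b' → let a' , a⇒a' , a'Rb' = back aRb b⇒b'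
                  w , r , w∈v = f a⇒a'
              in w , IsRho-bisim B n a'Rb' r , w∈v) ,
    All.map (λ (a' , a⇒a' , r) → let b' , b⇒b' , a'Rb' = forth aRb a⇒a'
                                  in b' , b⇒b' , IsRho-bisim B n a'Rb' r) g
    where open IsTreeBisim B

  IsRho-seq-downward : ∀ (z : Vω) a {n k} → n ≤′ k → IsRho G k a (seq z k) → IsRho G n a (seq z n)
  IsRho-seq-downward z a ≤′-refl            ρk = ρk
  IsRho-seq-downward z a (≤′-step {k} n≤k) ρk =
    IsRho-seq-downward z a n≤k (IsRho-resp-≋ k (coh z k) (IsRho-bang k ρk))

sublists : ∀ {A : Set} → List A → List (List A)
sublists []       = [] ∷ []
sublists (x ∷ xs) = map (x ∷_) (sublists xs) ++ sublists xs

filter-∈-sublists : ∀ {A : Set} {P : A → Set} (P? : Decidable P) xs → filter P? xs ∈ sublists xs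
filter-∈-sublists P? []       = here refl
filter-∈-sublists P? (x ∷ xs) with does (P? x)
... | true  = ∈-++⁺ˡ (∈-map⁺ (x ∷_) (filter-∈-sublists P? xs))
... | false = ∈-++⁺ʳ (map (x ∷_) (sublists xs)) (filter-∈-sublists P? xs)

InfinitelyOften : (ℕ → Set) → Set
InfinitelyOften P = ∀ m → ∃[ p ] (m ≤ p × P p)

module Classical (em : ExcludedMiddle (lsuc lzero)) where

  dec : (P : Set) → Dec P
  dec P = map′ lower lift (em {Lift (lsuc lzero) P})

  PF-enumerable : ∀ n → ∃[ es ] (∀ (v : PF n) → v ∈ₕ es)
  PF-enumerable zero    = tt ∷ [] , λ _ → here tt
  PF-enumerable (suc n) = sublists es , λ v → lose (filter-∈-sublists (λ e → dec (e ∈ₕ v)) es) (v≋ v)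
    where
    es = proj₁ (PF-enumerable n)
    es-complete = proj₂ (PF-enumerable n)
    v≋ : ∀ v → v ≋ filter (λ e → dec (e ∈ₕ v)) es
    v≋ v =
      (λ x x∈v → let e , e∈es , x≋e = find (es-complete x)
                 in lose (∈-filter⁺ (λ e → dec (e ∈ₕ v)) e∈es (∈ₕ-respˡ x≋e x∈v)) x≋e) ,
      (λ x x∈f → let e , e∈f , x≋e = find x∈f
                 in ∈ₕ-respˡ (≋-sym x≋e) (All.lookup (all-filter (λ e → dec (e ∈ₕ v)) es) e∈f))

  -- ρ_{n+1}(a) is the part of the finite set PF n realised by children of a; choosing it needs
  -- excluded middle when a branches infinitely.
  IsRho-exists : (G : RootedGraph) → IsTree G → ∀ n a → ∃[ v ] IsRho G n a v
  IsRho-exists G T zero    a = tt , tt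
  IsRho-exists G T (suc n) a = filter ρ? es , children , all-filter ρ? es
    where
    open RootedGraph G
    open Rho G T
    es = proj₁ (PF-enumerable n)
    ρ? : ∀ w → Dec (∃[ a' ] (a ⇒ a' × IsRho G n a' w))
    ρ? w = dec _
    children : ∀ {a'} → a ⇒ a' → ∃[ w ] (IsRho G n a' w × w ∈ₕ filter ρ? es)
    children {a'} a⇒a' =
      let w , ρw = IsRho-exists G T n a'
          e , e∈es , w≋e = find (proj₂ (PF-enumerable n) w)
          ρe = IsRho-resp-≋ n w≋e ρw
      in e , ρe , lose (∈-filter⁺ ρ? e∈es (a' , a⇒a' , ρe)) ≋-refl

  ¬infinitely⇒eventually¬ : ∀ {P} → ¬ InfinitelyOften P → ∃[ m ] (∀ p → m ≤ p → ¬ P p)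
  ¬infinitely⇒eventually¬ {P} ¬inf with dec (∃[ m ] (∀ p → m ≤ p → ¬ P p))
  ... | yes bound = bound
  ... | no ¬bound = ⊥-elim (¬inf witness)
    where
    witness : InfinitelyOften P
    witness m with dec (∃[ p ] (m ≤ p × P p))
    ... | yes found = found
    ... | no ¬found = ⊥-elim (¬bound (m , λ p m≤p Pp → ¬found (p , m≤p , Pp)))

  pigeonhole : ∀ {A : Set} (cs : List A) (P : ℕ → Set) (Q : ℕ → A → Set) → InfinitelyOften P →
               (∀ p → P p → Any (Q p) cs) → Any (λ c → InfinitelyOften (λ p → P p × Q p c)) cs
  pigeonhole [] P Q inf classify with inf 0
  ... | p , _ , Pp with classify p Pp
  ... | ()
  pigeonhole (c ∷ cs) P Q inf classify with dec (InfinitelyOften (λ p → P p × Q p c))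
  ... | yes infc = here infc
  ... | no ¬infc =
    there (Any.map forget-late (pigeonhole cs (λ p → P p × m₀ ≤ p) Q inf-late classify-late))
    where
    m₀ = proj₁ (¬infinitely⇒eventually¬ ¬infc)
    inf-late : InfinitelyOften (λ p → P p × m₀ ≤ p)
    inf-late m = let p , m⊔m₀≤p , Pp = inf (m ⊔ m₀)
                 in p , ≤-trans (m≤m⊔n m m₀) m⊔m₀≤p , Pp , ≤-trans (m≤n⊔m m m₀) m⊔m₀≤p
    forget-late : ∀ {c'} → InfinitelyOften (λ p → (P p × m₀ ≤ p) × Q p c') →
                  InfinitelyOften (λ p → P p × Q p c')
    forget-late inf' m = let p , m≤p , (Pp , _) , Qp = inf' m in p , m≤p , Pp , Qp
    classify-late : ∀ p → P p × m₀ ≤ p → Any (Q p) cs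
    classify-late p (Pp , m₀≤p) with classify p Pp
    ... | here Qpc   = ⊥-elim (proj₂ (¬infinitely⇒eventually¬ ¬infc) p m₀≤p (Pp , Qpc))
    ... | there Qpcs = Qpcs

module TreeProperties (G : RootedGraph) (T : IsTree G) where
  open RootedGraph G
  open IsTree T
  private module ≈ = IsEquivalence isEquivalence

  PathEq-refl : ∀ {a} (p : Path G a) → PathEq G p p
  PathEq-refl (start _)  = start
  PathEq-refl (step p _) = step (PathEq-refl p) ≈.refl

  PathEq-trans : ∀ {a b c} {p : Path G a} {q : Path G b} {r : Path G c} →
                 PathEq G p q → PathEq G q r → PathEq G p r
  PathEq-trans start           start           = start
  PathEq-trans (step p≡q x≈y) (step q≡r y≈z) = step (PathEq-trans p≡q q≡r) (≈.trans x≈y y≈z)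

  castPath : ∀ {a b} → a ≈ b → Path G a → Path G b
  castPath a≈b (start root≈a) = start (≈.trans root≈a a≈b)
  castPath a≈b (step p x⇒a)   = step p (⇒-resp ≈.refl a≈b x⇒a)

  castPath-PathEq : ∀ {a b} (a≈b : a ≈ b) (p : Path G a) → PathEq G (castPath a≈b p) p
  castPath-PathEq _ (start _)  = start
  castPath-PathEq _ (step p _) = step (PathEq-refl p) ≈.refl

  paths-unique : ∀ {a b} → a ≈ b → (p : Path G a) (q : Path G b) → PathEq G p q
  paths-unique a≈b p q = PathEq-trans (unique p (castPath (≈.sym a≈b) q)) (castPath-PathEq _ q)

  parent-unique : ∀ {pa pb a b} → pa ⇒ a → pb ⇒ b → a ≈ b → pa ≈ pb
  parent-unique {pa} {pb} pa⇒a pb⇒b a≈b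
    with paths-unique a≈b (step (reachable pa) pa⇒a) (step (reachable pb) pb⇒b)
  ... | step _ pa≈pb = pa≈pb

  root-parentless : ∀ {a b} → a ⇒ b → b ≈ root → ⊥
  root-parentless {a} a⇒b b≈root with paths-unique b≈root (step (reachable a) a⇒b) (start ≈.refl)
  ... | ()

record IsBoundedMorphism (G H : RootedGraph) (f : RootedGraph.Node G → RootedGraph.Node H) : Set where
  private
    module G = RootedGraph G
    module H = RootedGraph H
  field
    preserves-≈    : ∀ {a b} → a G.≈ b → f a H.≈ f b
    preserves-⇒    : ∀ {a b} → a G.⇒ b → f a H.⇒ f b
    preserves-root : f G.root H.≈ H.root
    lifts-⇒        : ∀ {a b'} → f a H.⇒ b' → ∃[ a' ] (a G.⇒ a' × f a' H.≈ b')

module BoundedMorphism {G H : RootedGraph} (TG : IsTree G) (TH : IsTree H)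
                       (SE : StronglyExtensional G)
                       {f : RootedGraph.Node G → RootedGraph.Node H} (M : IsBoundedMorphism G H f) where
  private
    module G = RootedGraph G
    module H = RootedGraph H
    module TG = IsTree TG
    module TH = IsTree TH
    module ≈G = IsEquivalence TG.isEquivalence
    module ≈H = IsEquivalence TH.isEquivalence
  open IsBoundedMorphism M

  Kernel : G.Node → G.Node → Set
  Kernel a b = f a H.≈ f b

  kernel-root : ∀ {b} → f G.root H.≈ f b → b G.≈ G.root
  kernel-root {b} fr≈fb with TG.reachable b
  ... | start root≈b  = ≈G.sym root≈b
  ... | step {pb} _ pb⇒b =
    ⊥-elim (TreeProperties.root-parentless H TH (preserves-⇒ pb⇒b) (≈H.trans (≈H.sym fr≈fb) preserves-root))

  kernel-isTreeBisim : IsTreeBisim G Kernel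
  kernel-isTreeBisim = record
    { forth   = forth
    ; back    = λ fa≈fb b⇒b' → let a' , a⇒a' , fa'≈fb' = forth (≈H.sym fa≈fb) b⇒b'
                               in a' , a⇒a' , ≈H.sym fa'≈fb'
    ; roots   = ≈H.refl
    ; rootˡ   = kernel-root
    ; rootʳ   = kernel-root ∘ ≈H.sym
    ; parents = λ pa⇒a pb⇒b fa≈fb →
        TreeProperties.parent-unique H TH (preserves-⇒ pa⇒a) (preserves-⇒ pb⇒b) fa≈fb
    }
    where
    forth : ∀ {a b} → Kernel a b → ∀ {a'} → a G.⇒ a' → ∃[ b' ] (b G.⇒ b' × Kernel a' b')
    forth fa≈fb a⇒a' = let b' , b⇒b' , fb'≈fa' = lifts-⇒ (TH.⇒-resp fa≈fb ≈H.refl (preserves-⇒ a⇒a'))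
                       in b' , b⇒b' , ≈H.sym fb'≈fa'

  injective : ∀ {a b} → f a H.≈ f b → a G.≈ b
  injective = SE Kernel kernel-isTreeBisim

  surjective : ∀ b → ∃[ a ] (f a H.≈ b)
  surjective b = along (TH.reachable b)
    where
    along : ∀ {b} → Path H b → ∃[ a ] (f a H.≈ b)
    along (start root≈b)  = G.root , ≈H.trans preserves-root root≈b
    along (step p pb⇒b) =
      let pa , fpa≈pb = along p
          a , pa⇒a , fa≈b = lifts-⇒ (TH.⇒-resp (≈H.sym fpa≈pb) ≈H.refl pb⇒b)
      in a , fa≈b

  isomorphism : G ≅ H
  isomorphism = record
    { to        = f
    ; from      = from
    ; to-cong   = preserves-≈
    ; from-cong = λ b≈b' → injective (≈H.trans (from-section _) (≈H.trans b≈b' (≈H.sym (from-section _))))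
    ; to-from   = from-section
    ; from-to   = λ a → injective (from-section (f a))
    ; to-edge   = preserves-⇒
    ; from-edge = from-edge
    ; to-root   = preserves-root
    }
    where
    from : H.Node → G.Node
    from b = proj₁ (surjective b)
    from-section : ∀ b → f (from b) H.≈ b
    from-section b = proj₂ (surjective b)
    from-edge : ∀ {b b'} → b H.⇒ b' → from b G.⇒ from b'
    from-edge b⇒b' =
      let a' , a⇒a' , fa'≈b' = lifts-⇒ (TH.⇒-resp (≈H.sym (from-section _)) ≈H.refl b⇒b')
      in TG.⇒-resp ≈G.refl (injective (≈H.trans fa'≈b' (≈H.sym (from-section _)))) a⇒a'

module Tr (x : Vω) where
  open RootedGraph (tr x)

  TrSeqEq-refl : ∀ {y} (s : TrSeq x y) → TrSeqEq x s s
  TrSeqEq-refl []           = []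
  TrSeqEq-refl (snoc s z e) = snoc {e = e} {e' = e} (TrSeqEq-refl s) (≈V-refl z)

  TrSeqEq-sym : ∀ {y y'} {s : TrSeq x y} {s' : TrSeq x y'} → TrSeqEq x s s' → TrSeqEq x s' s
  TrSeqEq-sym []               = []
  TrSeqEq-sym (snoc {z = z} {z'} s≈s' z≈z') = snoc (TrSeqEq-sym s≈s') (≈V-sym {z} {z'} z≈z')

  TrSeqEq-trans : ∀ {y y' y''} {s : TrSeq x y} {s' : TrSeq x y'} {s'' : TrSeq x y''} →
                  TrSeqEq x s s' → TrSeqEq x s' s'' → TrSeqEq x s s''
  TrSeqEq-trans []               []                 = []
  TrSeqEq-trans (snoc {z = z} {z'} s≈s' z≈z') (snoc {z' = z''} s'≈s'' z'≈z'') =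
    snoc (TrSeqEq-trans s≈s' s'≈s'') (≈V-trans {z} {z'} {z''} z≈z' z'≈z'')

  TrSeqEq⇒≈V : ∀ {y y'} {s : TrSeq x y} {s' : TrSeq x y'} → TrSeqEq x s s' → y ≈V y'
  TrSeqEq⇒≈V []         = ≈V-refl x
  TrSeqEq⇒≈V (snoc _ e) = e

  isEquivalence : IsEquivalence _≈_
  isEquivalence = record
    { refl  = λ {a} → TrSeqEq-refl (proj₂ a)
    ; sym   = TrSeqEq-sym
    ; trans = TrSeqEq-trans
    }

  ⇒-resp : ∀ {a a' b b'} → a ≈ a' → b ≈ b' → a ⇒ b → a' ⇒ b'
  ⇒-resp {b = _ , snoc _ _ _} a≈a' (snoc s≈s' _) a⇒b = TrSeqEq-trans (TrSeqEq-sym a≈a') (TrSeqEq-trans a⇒b s≈s')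

  parent-≈ : ∀ {a a' b b'} → a ⇒ b → a' ⇒ b' → b ≈ b' → a ≈ a'
  parent-≈ {b = _ , snoc _ _ _} {b' = _ , snoc _ _ _} a⇒b a'⇒b' (snoc s≈s' _) =
    TrSeqEq-trans a⇒b (TrSeqEq-trans s≈s' (TrSeqEq-sym a'⇒b'))

  sibling-≈ : ∀ {a a' b b'} → a ⇒ b → a' ⇒ b' → a ≈ a' → proj₁ b ≈V proj₁ b' → b ≈ b'
  sibling-≈ {b = _ , snoc _ _ _} {b' = _ , snoc _ _ _} a⇒b a'⇒b' a≈a' z≈z' =
    snoc (TrSeqEq-trans (TrSeqEq-sym a⇒b) (TrSeqEq-trans a≈a' a'⇒b')) z≈z'

  root-parentless : ∀ {a b} → root ≈ b → a ⇒ b → ⊥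
  root-parentless {b = _ , []} _ ()

  child-⇝ : ∀ {a b} → a ⇒ b → proj₁ a ⇝ proj₁ b
  child-⇝ {a = y , _} {b = z , snoc {y'} _ _ y'⇝z} a⇒b =
    ⇝-resp {y'} {y} {z} {z} (TrSeqEq⇒≈V (TrSeqEq-sym a⇒b)) (≈V-refl z) y'⇝z

  isTree : IsTree (tr x)
  isTree = record
    { isEquivalence = isEquivalence
    ; ⇒-resp        = ⇒-resp
    ; reachable     = λ (_ , s) → reach s
    ; unique        = λ p q → paths-unique p q (TrSeqEq-refl _)
    }
    where
    reach : ∀ {y} (s : TrSeq x y) → Path (tr x) (y , s)
    reach []           = start []
    reach (snoc s _ _) = step (reach s) (TrSeqEq-refl s)

    paths-unique : ∀ {a b} (p : Path (tr x) a) (q : Path (tr x) b) → a ≈ b → PathEq (tr x) p q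
    paths-unique (start _)     (start _)     _   = start
    paths-unique (start r≈a)   (step _ c⇒b)  a≈b = ⊥-elim (root-parentless (TrSeqEq-trans r≈a a≈b) c⇒b)
    paths-unique (step _ c⇒a)  (start r≈b)   a≈b = ⊥-elim (root-parentless (TrSeqEq-trans r≈b (TrSeqEq-sym a≈b)) c⇒a)
    paths-unique (step p c⇒a)  (step q d⇒b)  a≈b = step (paths-unique p q c≈d) c≈d
      where c≈d = parent-≈ c⇒a d⇒b a≈b

  open Rho (tr x) isTree

  IsRho-tr : ∀ n a → IsRho (tr x) n a (seq (proj₁ a) n)
  IsRho-tr zero    _       = tt
  IsRho-tr (suc n) (y , s) =
    (λ {a'} a⇒a' → seq (proj₁ a') n , IsRho-tr n a' , child-⇝ a⇒a' n) ,
    All.tabulate λ w∈y →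
      let z , y⇝z , z≋w = ⇝-realize y n (lose w∈y ≋-refl)
      in (z , snoc s z y⇝z) , TrSeqEq-refl s , IsRho-resp-≋ n z≋w (IsRho-tr n (z , snoc s z y⇝z))

  stronglyExtensional : StronglyExtensional (tr x)
  stronglyExtensional R B {a} {b} = related⇒≈ (proj₂ a) b
    where
    open IsTreeBisim B
    related⇒≈V : ∀ {a b} → R a b → proj₁ a ≈V proj₁ b
    related⇒≈V {a} {b} aRb n = IsRho-functional n (IsRho-bisim B n aRb (IsRho-tr n a)) (IsRho-tr n b)

    related⇒≈ : ∀ {y} (s : TrSeq x y) b → R (y , s) b → TrSeqEq x s (proj₂ b)
    related⇒≈ []           b                 aRb = TrSeqEq-sym (rootˡ aRb)
    related⇒≈ (snoc s z e) (_ , [])          aRb with rootʳ aRb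
    ... | ()
    related⇒≈ (snoc s z e) (_ , snoc s' _ _) aRb =
      snoc (related⇒≈ s (_ , s') (parents (TrSeqEq-refl s) (TrSeqEq-refl s') aRb)) (related⇒≈V aRb)

  -- Pigeonholing the children level by level yields nested infinite clusters that agree up to
  -- level n; their centres form the limit, and a diagonal choice gives the subsequence.
  module Convergence (em : ExcludedMiddle (lsuc lzero)) {y} (s : TrSeq x y)
                     (ys : ℕ → Node) (y⇒ys : ∀ p → (y , s) ⇒ ys p) where
    open Classical em

    Z : ℕ → Vω
    Z p = proj₁ (ys p)

    record Cluster (n : ℕ) : Set₁ where
      field
        member   : ℕ → Set
        centre   : PF n
        infinite : InfinitelyOften member
        agree    : ∀ {p} → member p → seq (Z p) n ≋ centre
    open Cluster

    refine : ∀ {n} → Cluster n → Cluster (suc n)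
    refine {n} C = record
      { member   = λ p → member C p × seq (Z p) (suc n) ≋ centre'
      ; centre   = centre'
      ; infinite = proj₂ found
      ; agree    = proj₂
      }
      where
      found = Any.satisfied (pigeonhole (seq y (suc (suc n))) (member C) (λ p c → seq (Z p) (suc n) ≋ c)
                                        (infinite C) (λ p _ → child-⇝ (y⇒ys p) (suc n)))
      centre' = proj₁ found

    cluster : ∀ n → Cluster n
    cluster zero    = record { member = λ _ → ⊤ ; centre = tt ; infinite = λ m → m , ≤-refl , tt ; agree = λ _ → tt }
    cluster (suc n) = refine (cluster n)

    member-mono : ∀ {n k} → n ≤′ k → ∀ {p} → member (cluster k) p → member (cluster n) p
    member-mono ≤′-refl     p∈C = p∈C
    member-mono (≤′-step q) p∈C = member-mono q (proj₁ p∈C)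

    limit : Vω
    limit = mkV (centre ∘ cluster) centre-coh
      where
      centre-coh : ∀ n → bang n (centre (cluster (suc n))) ≋ centre (cluster n)
      centre-coh n =
        let p , _ , p∈C = infinite (cluster (suc n)) 0
        in ≋-trans (bang-cong n (≋-sym (proj₂ p∈C))) (≋-trans (coh (Z p) n) (agree (cluster n) (proj₁ p∈C)))

    y⇝limit : y ⇝ limit
    y⇝limit n = let p , _ , p∈C = infinite (cluster n) 0 in ∈ₕ-respˡ (agree (cluster n) p∈C) (child-⇝ (y⇒ys p) n)

    limit-node : Node
    limit-node = limit , snoc s limit y⇝limit

    σ : ℕ → ℕ
    σ zero    = proj₁ (infinite (cluster 0) 0)
    σ (suc k) = proj₁ (infinite (cluster (suc k)) (suc (σ k)))

    σ-increasing : ∀ k → σ k < σ (suc k)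
    σ-increasing k = proj₁ (proj₂ (infinite (cluster (suc k)) (suc (σ k))))

    σ-member : ∀ k → member (cluster k) (σ k)
    σ-member zero    = proj₂ (proj₂ (infinite (cluster 0) 0))
    σ-member (suc k) = proj₂ (proj₂ (infinite (cluster (suc k)) (suc (σ k))))

    converges : Lim (tr x) (ys ∘ σ) limit-node
    converges n = n , λ p n≤p →
      centre (cluster n) ,
      IsRho-resp-≋ n (agree (cluster n) (member-mono (≤⇒≤′ n≤p) (σ-member p))) (IsRho-tr n (ys (σ p))) ,
      IsRho-tr n limit-node

  compactlyBranching : ExcludedMiddle (lsuc lzero) → CompactlyBranching (tr x)
  compactlyBranching em (y , s) ys y⇒ys =
    σ , σ-increasing , limit-node , TrSeqEq-refl s , converges
    where open Convergence em s ys y⇒ys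

module Unfolding (G : RootedGraph) (T : IsTree G) (label : RootedGraph.Node G → Vω)
                 (label-cong : ∀ {a b} → RootedGraph._≈_ G a b → label a ≈V label b)
                 (label-⇝ : ∀ {a b} → RootedGraph._⇒_ G a b → label a ⇝ label b) where
  open RootedGraph G
  open IsTree T
  open TreeProperties G T using (paths-unique)
  private module ≈ = IsEquivalence isEquivalence

  x₀ : Vω
  x₀ = label root

  private module T₀ = Tr x₀
  open RootedGraph (tr x₀) using () renaming (Node to Node₀; _≈_ to _≈₀_; _⇒_ to _⇒₀_; root to root₀)

  unfoldPath : ∀ {a} → Path G a → Σ[ s ∈ Node₀ ] (proj₁ s ≈V label a)
  unfoldPath (start root≈a) = (x₀ , []) , label-cong root≈a
  unfoldPath {b} (step {a} p a⇒b) =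
    let (y , s) , y≈a = unfoldPath p
        y⇝b = ⇝-resp {label a} {y} {label b} {label b} (≈V-sym {y} {label a} y≈a) (≈V-refl (label b)) (label-⇝ a⇒b)
    in (label b , snoc s (label b) y⇝b) , ≈V-refl (label b)

  unfoldPath-PathEq : ∀ {a b} {p : Path G a} {q : Path G b} → PathEq G p q → a ≈ b →
                      proj₁ (unfoldPath p) ≈₀ proj₁ (unfoldPath q)
  unfoldPath-PathEq start                _   = []
  unfoldPath-PathEq (step p≡q pa≈pb) a≈b = snoc (unfoldPath-PathEq p≡q pa≈pb) (label-cong a≈b)

  unfold : Node → Node₀
  unfold a = proj₁ (unfoldPath (reachable a))

  unfold-label : ∀ a → proj₁ (unfold a) ≈V label a
  unfold-label a = proj₂ (unfoldPath (reachable a))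

  unfold-cong : ∀ {a b} → a ≈ b → unfold a ≈₀ unfold b
  unfold-cong {a} {b} a≈b = unfoldPath-PathEq (paths-unique a≈b (reachable a) (reachable b)) a≈b

  unfold-⇒ : ∀ {a b} → a ⇒ b → unfold a ⇒₀ unfold b
  unfold-⇒ {a} {b} a⇒b = via (reachable b) (unique (step (reachable a) a⇒b) (reachable b))
    where
    via : (q : Path G b) → PathEq G (step (reachable a) a⇒b) q → unfold a ⇒₀ proj₁ (unfoldPath q)
    via (step q _) (step p≡q a≈pb) = unfoldPath-PathEq p≡q a≈pb

  unfold-root : unfold root ≈₀ root₀
  unfold-root = via (reachable root) (unique (start ≈.refl) (reachable root))
    where
    via : (q : Path G root) → PathEq G (start {x = root} ≈.refl) q → proj₁ (unfoldPath q) ≈₀ root₀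
    via (start _) start = []

  unfold-isBoundedMorphism : (∀ a z → label a ⇝ z → ∃[ a' ] (a ⇒ a' × label a' ≈V z)) →
                             IsBoundedMorphism G (tr x₀) unfold
  unfold-isBoundedMorphism realize = record
    { preserves-≈    = unfold-cong
    ; preserves-⇒    = unfold-⇒
    ; preserves-root = unfold-root
    ; lifts-⇒        = lifts
    }
    where
    lifts : ∀ {a b'} → unfold a ⇒₀ b' → ∃[ a' ] (a ⇒ a' × unfold a' ≈₀ b')
    lifts {a} {b'@(z , _)} a⇒b' =
      let a' , a⇒a' , a'≈z = realize a z (⇝-resp {proj₁ (unfold a)} {label a} {z} {z}
                                                 (unfold-label a) (≈V-refl z) (T₀.child-⇝ a⇒b'))
      in a' , a⇒a' ,
         T₀.sibling-≈ (unfold-⇒ a⇒a') a⇒b' (T₀.TrSeqEq-refl (proj₂ (unfold a)))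
                      (≈V-trans {proj₁ (unfold a')} {label a'} {z} (unfold-label a') a'≈z)

increasing⇒≤ : (σ : ℕ → ℕ) → (∀ n → σ n < σ (suc n)) → ∀ p → p ≤ σ p
increasing⇒≤ σ σ-inc zero    = z≤n
increasing⇒≤ σ σ-inc (suc p) = ≤-trans (s≤s (increasing⇒≤ σ σ-inc p)) (σ-inc p)

module Behaviour (em : ExcludedMiddle (lsuc lzero)) (G : RootedGraph) (T : IsTree G) where
  open RootedGraph G
  open Rho G T
  open Classical em using (IsRho-exists)

  ρ : Node → (n : ℕ) → PF n
  ρ a n = proj₁ (IsRho-exists G T n a)

  ρ-IsRho : ∀ a n → IsRho G n a (ρ a n)
  ρ-IsRho a n = proj₂ (IsRho-exists G T n a)

  ρ̂ : Node → Vω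
  ρ̂ a = mkV (ρ a) (λ n → IsRho-functional n (IsRho-bang n (ρ-IsRho a (suc n))) (ρ-IsRho a n))

  ρ̂-cong : ∀ {a b} → a ≈ b → ρ̂ a ≈V ρ̂ b
  ρ̂-cong {a} {b} a≈b n = IsRho-functional n (IsRho-resp-≈ n a≈b (ρ-IsRho a n)) (ρ-IsRho b n)

  ρ̂-⇝ : ∀ {a b} → a ⇒ b → ρ̂ a ⇝ ρ̂ b
  ρ̂-⇝ {a} {b} a⇒b n =
    let w , ρw , w∈ρa = proj₁ (ρ-IsRho a (suc n)) a⇒b
    in ∈ₕ-respˡ (IsRho-functional n ρw (ρ-IsRho b n)) w∈ρa

  -- Children whose behaviour approximates z to ever higher levels have, by compact branching,
  -- a convergent subsequence; its limit is a child with behaviour exactly z.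
  ρ̂-realize : CompactlyBranching G → ∀ a z → ρ̂ a ⇝ z → ∃[ a' ] (a ⇒ a' × ρ̂ a' ≈V z)
  ρ̂-realize cb a z ρ̂a⇝z =
    let σ , σ-inc , a' , a⇒a' , bs∘σ→a' = cb a bs (proj₁ ∘ proj₂ ∘ approximant)
    in a' , a⇒a' , limit-behaviour σ σ-inc a' bs∘σ→a'
    where
    approximant : ∀ n → ∃[ b ] (a ⇒ b × IsRho G n b (seq z n))
    approximant n =
      let u , u∈ρa , z≋u = find (ρ̂a⇝z n)
          b , a⇒b , ρb = All.lookup (proj₂ (ρ-IsRho a (suc n))) u∈ρa
      in b , a⇒b , IsRho-resp-≋ n (≋-sym z≋u) ρb

    bs : ℕ → Node
    bs n = proj₁ (approximant n)

    limit-behaviour : ∀ σ → (∀ n → σ n < σ (suc n)) → ∀ a' → Lim G (bs ∘ σ) a' → ρ̂ a' ≈V z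
    limit-behaviour σ σ-inc a' bs∘σ→a' n =
      let m , close = bs∘σ→a' n
          p = m + n
          n≤σp = ≤-trans (m≤n+m n m) (increasing⇒≤ σ σ-inc p)
          ρbσp = IsRho-seq-downward z (bs (σ p)) (≤⇒≤′ n≤σp) (proj₂ (proj₂ (approximant (σ p))))
      in IsRho-functional n (ρ-IsRho a' n) (SameRho-transport n (close p (m≤m+n m n)) ρbσp)

lemmaA13 : ExcludedMiddle (lsuc lzero) →
    ((x : Vω) → IsTree (tr x) × CompactlyBranching (tr x) × StronglyExtensional (tr x))
    × ((t : RootedGraph) → IsTree t → CompactlyBranching t → StronglyExtensional t →
    ∃[ x ] (t ≅ tr x))
lemmaA13 em =
  (λ x → Tr.isTree x , Tr.compactlyBranching x em , Tr.stronglyExtensional x) ,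
  λ t T cb se →
    let open Behaviour em t T
        open Unfolding t T ρ̂ ρ̂-cong ρ̂-⇝
    in x₀ , BoundedMorphism.isomorphism T (Tr.isTree x₀) se (unfold-isBoundedMorphism (ρ̂-realize cb))
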